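{- For every $n$-vertex graph $G$ we have $\operatorname{av}(K_n)\geq \operatorname{av}(G)$, with equality only if $G$ is a complete graph.
   Context: A matching of a graph is a set of pairwise vertex-disjoint edges; $m(G,k)$ denotes the number of matchings of cardinality $k$ in $G$, and $\operatorname{av}(G)=\frac{\sum_{k\ge0}k\,m(G,k)}{\sum_{k\ge0}m(G,k)}$ is the average size of a matching of $G$. $K_n$ is the complete graph on $n$ vertices. -}

module Defs where

open import Data.Bool using (Bool; true; false; not; _∧_; _∨_)
open import Data.Nat using (ℕ; zero; suc; _+_; _*_; _≡ᵇ_; _<ᵇ_; NonZero)
open import Data.Nat.Properties using (≡ᵇ⇒≡)
open import Data.Fin using (Fin; toℕ)
open import Data.Fin.Properties using (toℕ-injective)
open import Data.List using (List; []; _∷_; _++_; map; concatMap; filterᵇ; length; allFin)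
open import Data.Bool.ListAction using (and)
open import Data.Product using (_×_; _,_; proj₁; proj₂; ∃)
open import Data.Integer using (+_)
open import Data.Rational using (ℚ; _/_)
open import Relation.Binary.PropositionalEquality using (_≡_; refl; sym; cong)

record Graph (n : ℕ) : Set where
  field
    adj    : Fin n → Fin n → Bool
    adj-sym    : ∀ i j → adj i j ≡ adj j i
    adj-irrefl : ∀ i → adj i i ≡ false
open Graph public

_=ᵛ_ : ∀ {n} → Fin n → Fin n → Bool
i =ᵛ j = toℕ i ≡ᵇ toℕ j

private
  ≡ᵇ-refl : ∀ m → (m ≡ᵇ m) ≡ true
  ≡ᵇ-refl zero = refl
  ≡ᵇ-refl (suc m) = ≡ᵇ-refl m

  ≡ᵇ-sym : ∀ m k → (m ≡ᵇ k) ≡ (k ≡ᵇ m)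
  ≡ᵇ-sym zero zero = refl
  ≡ᵇ-sym zero (suc k) = refl
  ≡ᵇ-sym (suc m) zero = refl
  ≡ᵇ-sym (suc m) (suc k) = ≡ᵇ-sym m k

complete : (n : ℕ) → Graph n
complete n = record
  { adj = λ i j → not (i =ᵛ j)
  ; adj-sym = λ i j → cong not (≡ᵇ-sym (toℕ i) (toℕ j))
  ; adj-irrefl = λ i → cong not (≡ᵇ-refl (toℕ i))
  }

Edge : ℕ → Set
Edge n = Fin n × Fin n

-- The edge list of G: each edge {i,j} listed once as (i , j) with i < j.
edges : ∀ {n} → Graph n → List (Edge n)
edges {n} G =
  filterᵇ (λ e → adj G (proj₁ e) (proj₂ e))
    (concatMap (λ i → map (λ j → (i , j)) (filterᵇ (λ j → toℕ i <ᵇ toℕ j) (allFin n)))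
      (allFin n))

subs : ∀ {A : Set} → List A → List (List A)
subs [] = [] ∷ []
subs (x ∷ xs) = subs xs ++ map (x ∷_) (subs xs)

disjoint : ∀ {n} → Edge n → Edge n → Bool
disjoint (a , b) (c , d) = not ((a =ᵛ c) ∨ (a =ᵛ d) ∨ (b =ᵛ c) ∨ (b =ᵛ d))

isMatching : ∀ {n} → List (Edge n) → Bool
isMatching [] = true
isMatching (e ∷ es) = and (map (disjoint e) es) ∧ isMatching es

matchings : ∀ {n} → Graph n → List (List (Edge n))
matchings G = filterᵇ isMatching (subs (edges G))

m : ∀ {n} → Graph n → ℕ → ℕ
m G k = length (filterᵇ (λ M → isMatching M ∧ (length M ≡ᵇ k)) (subs (edges G)))

sumTo : ℕ → (ℕ → ℕ) → ℕ
sumTo zero f = f zero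
sumTo (suc K) f = sumTo K f + f (suc K)

-- Σ_{k ≥ 0} m(G,k)   (terms with k > |E(G)| vanish)
totalMatchings : ∀ {n} → Graph n → ℕ
totalMatchings G = sumTo (length (edges G)) (m G)

weightedMatchings : ∀ {n} → Graph n → ℕ
weightedMatchings G = sumTo (length (edges G)) (λ k → k * m G k)

-- Helper facts: the empty matching exists, so the denominator is nonzero.
subs-head : ∀ {A : Set} (xs : List A) → ∃ λ rest → subs xs ≡ [] ∷ rest
subs-head [] = [] , refl
subs-head (x ∷ xs) with subs xs | subs-head xs
... | .([] ∷ rest) | rest , refl = (rest ++ map (x ∷_) ([] ∷ rest)) , refl

m0-nonzero : ∀ {n} (G : Graph n) → NonZero (m G 0)
m0-nonzero G with subs (edges G) | subs-head (edges G)
... | .([] ∷ rest) | rest , refl = _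

sumTo-nonzero : ∀ K f → NonZero (f zero) → NonZero (sumTo K f)
sumTo-nonzero zero f nz = nz
sumTo-nonzero (suc K) f nz with sumTo K f | sumTo-nonzero K f nz
... | suc s | _ = _

totalMatchings-nonzero : ∀ {n} (G : Graph n) → NonZero (totalMatchings G)
totalMatchings-nonzero G = sumTo-nonzero (length (edges G)) (m G) (m0-nonzero G)

av : ∀ {n} → Graph n → ℚ
av G = _/_ (+ weightedMatchings G) (totalMatchings G) {{totalMatchings-nonzero G}}

module Submission where

-- Write d_k = m(G,k) and p_k = m(Kₙ,k). Every k-matching of G is one of Kₙ, so d_k ≤ p_k.
-- Counting the pairs (M, e) of a k-matching M and an edge e disjoint from it gives
-- (k+1) m(H,k+1) = Σ_M #{edges of H disjoint from M}, and a k-matching of Kₙ leaves exactly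
-- C(n−2k, 2) such edges; hence (k+1) d_{k+1} ≤ C(n−2k, 2) d_k, with equality for p. So d_k / p_k
-- is nonincreasing, and Chebyshev's sum inequality gives Σ k d_k · Σ p_k ≤ Σ k p_k · Σ d_k,
-- i.e. av(G) ≤ av(Kₙ). If G misses an edge then d_1 < p_1 while d_0 = p_0 = 1, which makes
-- the inequality strict.

import Algebra.Solver.CommutativeMonoid as CommutativeMonoidSolver
open import Data.Bool using (Bool; true; false; not; _∧_; _∨_; T)
open import Data.Bool.ListAction using (all)
open import Data.Bool.Properties
  using (∧-comm; ∧-identityʳ; ∧-zeroʳ; ∧-conicalˡ; ∧-conicalʳ; not-injective; ¬-not;
         ∧-commutativeMonoid; ∨-commutativeMonoid)
open import Data.Empty using (⊥-elim)
open import Data.Fin using (Fin; toℕ)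
import Data.Fin as Fin
open import Data.Fin.Properties using (toℕ-injective)
import Data.Integer as ℤ
import Data.Integer.Properties as ℤᵖ
open import Data.List using (List; []; _∷_; _++_; map; concatMap; filterᵇ; length; allFin; tabulate)
open import Data.List.Membership.Propositional using (_∈_)
import Data.List.Relation.Unary.Any as Any
open import Data.Nat using (ℕ; zero; suc; _+_; _*_; _∸_; _≤_; _<_; _≡ᵇ_; _<ᵇ_; z≤n; s≤s; NonZero)
open import Data.Nat.Combinatorics using (_C_; nC1≡n; nCk+nC[k+1]≡[n+1]C[k+1])
open import Data.Nat.Properties
open import Data.Nat.Tactic.RingSolver using (solve-∀)
open import Data.Product using (_×_; _,_; proj₁; proj₂)
import Data.Rational as ℚ
open import Data.Rational.Properties using (toℚᵘ-cancel-≤; toℚᵘ-fromℚᵘ; normalize-injective-≃)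
import Data.Rational.Unnormalised as ℚᵘ
import Data.Rational.Unnormalised.Properties as ℚᵘᵖ
open import Data.Sum using (inj₁; inj₂)
open import Function using (_∘_)
open import Relation.Binary using (tri<; tri≈; tri>)
open import Relation.Binary.PropositionalEquality

open import Algebra.Properties.Semiring.Sum +-*-semiring
  using (sum; sum-syntax; sum-cong-≗; ∑-distrib-+; *-distribˡ-sum)

open import Defs

module ∧-Solver = CommutativeMonoidSolver ∧-commutativeMonoid
module ∨-Solver = CommutativeMonoidSolver ∨-commutativeMonoid

⟦_⟧ : Bool → ℕ
⟦ true  ⟧ = 1
⟦ false ⟧ = 0

⟦⟧-∧ : ∀ a b → ⟦ a ∧ b ⟧ ≡ ⟦ a ⟧ * ⟦ b ⟧
⟦⟧-∧ true  b = sym (+-identityʳ ⟦ b ⟧)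
⟦⟧-∧ false b = refl

⟦⟧-mono : ∀ {a b} → (a ≡ true → b ≡ true) → ⟦ a ⟧ ≤ ⟦ b ⟧
⟦⟧-mono {false} _   = z≤n
⟦⟧-mono {true}  a⇒b rewrite a⇒b refl = ≤-refl

≡ᵇ-sym : ∀ a b → (a ≡ᵇ b) ≡ (b ≡ᵇ a)
≡ᵇ-sym zero    zero    = refl
≡ᵇ-sym zero    (suc b) = refl
≡ᵇ-sym (suc a) zero    = refl
≡ᵇ-sym (suc a) (suc b) = ≡ᵇ-sym a b

≡ᵇ-refl : ∀ a → (a ≡ᵇ a) ≡ true
≡ᵇ-refl zero    = refl
≡ᵇ-refl (suc a) = ≡ᵇ-refl a

<ᵇ⇒≢ᵇ : ∀ a b → (a <ᵇ b) ≡ true → (a ≡ᵇ b) ≡ false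
<ᵇ⇒≢ᵇ zero    (suc b) _ = refl
<ᵇ⇒≢ᵇ (suc a) (suc b) p = <ᵇ⇒≢ᵇ a b p

<⇒<ᵇ≡true : ∀ {a b} → a < b → (a <ᵇ b) ≡ true
<⇒<ᵇ≡true {zero}  (s≤s _)   = refl
<⇒<ᵇ≡true {suc a} (s≤s a<b) = <⇒<ᵇ≡true a<b

⟦⟧*-≤ : ∀ {b x c} → (b ≡ true → x ≤ c) → ⟦ b ⟧ * x ≤ c * ⟦ b ⟧
⟦⟧*-≤ {false}         _   = z≤n
⟦⟧*-≤ {true} {x} {c} x≤c = subst₂ _≤_ (sym (+-identityʳ x)) (sym (*-identityʳ c)) (x≤c refl)

⟦⟧*-≡ : ∀ {b x c} → (b ≡ true → x ≡ c) → ⟦ b ⟧ * x ≡ c * ⟦ b ⟧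
⟦⟧*-≡ {false} {c = c} _   = sym (*-zeroʳ c)
⟦⟧*-≡ {true}  {x} {c} x≡c = trans (+-identityʳ x) (trans (x≡c refl) (sym (*-identityʳ c)))

⟦⟧-split : ∀ x y b → x ∧ y ≡ false → ⟦ b ⟧ ≡ ⟦ not (x ∨ y) ∧ b ⟧ + ⟦ x ⟧ * ⟦ b ⟧ + ⟦ y ⟧ * ⟦ b ⟧
⟦⟧-split true  true  b     ()
⟦⟧-split true  false true  _ = refl
⟦⟧-split true  false false _ = refl
⟦⟧-split false true  true  _ = refl
⟦⟧-split false true  false _ = refl
⟦⟧-split false false true  _ = refl
⟦⟧-split false false false _ = refl

not-∨-split : ∀ p q r s → not (p ∨ (q ∨ (r ∨ s))) ≡ not (p ∨ q) ∧ not (r ∨ s)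
not-∨-split true  q     r s = refl
not-∨-split false true  r s = refl
not-∨-split false false r s = refl

module _ {A : Set} where

  sumOver : List A → (A → ℕ) → ℕ
  sumOver []       f = 0
  sumOver (x ∷ xs) f = f x + sumOver xs f

  sumOver-mono-≤ : ∀ xs {f g : A → ℕ} → (∀ x → f x ≤ g x) → sumOver xs f ≤ sumOver xs g
  sumOver-mono-≤ []       f≤g = z≤n
  sumOver-mono-≤ (x ∷ xs) f≤g = +-mono-≤ (f≤g x) (sumOver-mono-≤ xs f≤g)

  sumOver-++ : ∀ xs ys (f : A → ℕ) → sumOver (xs ++ ys) f ≡ sumOver xs f + sumOver ys f
  sumOver-++ []       ys f = refl
  sumOver-++ (x ∷ xs) ys f = trans (cong (f x +_) (sumOver-++ xs ys f)) (sym (+-assoc (f x) _ _))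

  sumOver-*ˡ : ∀ xs c (f : A → ℕ) → sumOver xs (λ x → c * f x) ≡ c * sumOver xs f
  sumOver-*ˡ []       c f = sym (*-zeroʳ c)
  sumOver-*ˡ (x ∷ xs) c f =
    trans (cong (c * f x +_) (sumOver-*ˡ xs c f)) (sym (*-distribˡ-+ c (f x) _))

  sumOver-filterᵇ : ∀ (q : A → Bool) xs f → sumOver (filterᵇ q xs) f ≡ sumOver xs (λ x → ⟦ q x ⟧ * f x)
  sumOver-filterᵇ q []       f = refl
  sumOver-filterᵇ q (x ∷ xs) f with q x
  ... | true  = cong₂ _+_ (sym (+-identityʳ (f x))) (sumOver-filterᵇ q xs f)
  ... | false = sumOver-filterᵇ q xs f

  length-filterᵇ : ∀ (q : A → Bool) xs → length (filterᵇ q xs) ≡ sumOver xs (⟦_⟧ ∘ q)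
  length-filterᵇ q []       = refl
  length-filterᵇ q (x ∷ xs) with q x
  ... | true  = cong suc (length-filterᵇ q xs)
  ... | false = length-filterᵇ q xs

  sumOver-tabulate : ∀ {n} (f : Fin n → A) g → sumOver (tabulate f) g ≡ ∑[ i < n ] g (f i)
  sumOver-tabulate {zero}  f g = refl
  sumOver-tabulate {suc n} f g = cong (g (f Fin.zero) +_) (sumOver-tabulate (f ∘ Fin.suc) g)

sumOver-map : ∀ {A B : Set} (f : A → B) xs g → sumOver (map f xs) g ≡ sumOver xs (g ∘ f)
sumOver-map f []       g = refl
sumOver-map f (x ∷ xs) g = cong (g (f x) +_) (sumOver-map f xs g)

sumOver-concatMap : ∀ {A B : Set} (f : A → List B) xs g →
                    sumOver (concatMap f xs) g ≡ sumOver xs (λ x → sumOver (f x) g)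
sumOver-concatMap f []       g = refl
sumOver-concatMap f (x ∷ xs) g =
  trans (sumOver-++ (f x) (concatMap f xs) g) (cong (sumOver (f x) g +_) (sumOver-concatMap f xs g))

sum-mono-≤ : ∀ {n} {f g : Fin n → ℕ} → (∀ i → f i ≤ g i) → sum f ≤ sum g
sum-mono-≤ {zero}  f≤g = z≤n
sum-mono-≤ {suc n} f≤g = +-mono-≤ (f≤g Fin.zero) (sum-mono-≤ (f≤g ∘ Fin.suc))

sum-mono-< : ∀ {n} {f g : Fin n → ℕ} → (∀ i → f i ≤ g i) → ∀ i → f i < g i → sum f < sum g
sum-mono-< f≤g Fin.zero    f<g = +-mono-<-≤ f<g (sum-mono-≤ (f≤g ∘ Fin.suc))
sum-mono-< f≤g (Fin.suc i) f<g = +-mono-≤-< (f≤g Fin.zero) (sum-mono-< (f≤g ∘ Fin.suc) i f<g)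

sum-ones : ∀ n → ∑[ i < n ] 1 ≡ n
sum-ones zero    = refl
sum-ones (suc n) = cong suc (sum-ones n)

sum-δ : ∀ {n} (a : Fin n) (h : Fin n → ℕ) → ∑[ i < n ] (⟦ toℕ i ≡ᵇ toℕ a ⟧ * h i) ≡ h a
sum-δ {suc n} Fin.zero h = begin
  ∑[ i < suc n ] (⟦ toℕ i ≡ᵇ 0 ⟧ * h i)  ≡⟨ cong (h Fin.zero + 0 +_) (sum-cong-≗ {n} (λ _ → refl)) ⟩
  h Fin.zero + 0 + ∑[ i < n ] 0         ≡⟨ cong (h Fin.zero + 0 +_) (sum-zero n) ⟩
  h Fin.zero + 0 + 0                    ≡⟨ trans (+-identityʳ _) (+-identityʳ _) ⟩
  h Fin.zero                            ∎
  where
  open ≡-Reasoning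
  sum-zero : ∀ m → ∑[ i < m ] 0 ≡ 0
  sum-zero zero    = refl
  sum-zero (suc m) = sum-zero m
sum-δ {suc n} (Fin.suc a) h = sum-δ a (h ∘ Fin.suc)

pairProducts : ∀ {n} → (Fin n → ℕ) → ℕ
pairProducts {n} a = ∑[ i < n ] ∑[ j < n ] (⟦ toℕ i <ᵇ toℕ j ⟧ * (a i * a j))

pairProducts-suc : ∀ {n} (a : Fin (suc n) → ℕ) →
  pairProducts a ≡ a Fin.zero * ∑[ j < n ] a (Fin.suc j) + pairProducts (a ∘ Fin.suc)
pairProducts-suc {n} a = cong (_+ pairProducts (a ∘ Fin.suc))
  (trans (sum-cong-≗ {n} (λ j → +-identityʳ (a Fin.zero * a (Fin.suc j)))) (sym (*-distribˡ-sum (a Fin.zero) (a ∘ Fin.suc))))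

[⟦b⟧+r]C2 : ∀ b r → (⟦ b ⟧ + r) C 2 ≡ ⟦ b ⟧ * r + r C 2
[⟦b⟧+r]C2 false r = refl
[⟦b⟧+r]C2 true  r = begin
  suc r C 2        ≡⟨ nCk+nC[k+1]≡[n+1]C[k+1] r 1 ⟨
  r C 1 + r C 2    ≡⟨ cong (_+ r C 2) (trans (nC1≡n r) (sym (*-identityˡ r))) ⟩
  1 * r + r C 2    ∎
  where open ≡-Reasoning

pairProducts-⟦⟧ : ∀ {n} (u : Fin n → Bool) → pairProducts (⟦_⟧ ∘ u) ≡ (∑[ i < n ] ⟦ u i ⟧) C 2
pairProducts-⟦⟧ {zero}  u = refl
pairProducts-⟦⟧ {suc n} u = begin
  pairProducts (⟦_⟧ ∘ u)                                 ≡⟨ pairProducts-suc (⟦_⟧ ∘ u) ⟩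
  ⟦ u Fin.zero ⟧ * r + pairProducts (⟦_⟧ ∘ u ∘ Fin.suc)
    ≡⟨ cong (⟦ u Fin.zero ⟧ * r +_) (pairProducts-⟦⟧ (u ∘ Fin.suc)) ⟩
  ⟦ u Fin.zero ⟧ * r + r C 2                             ≡⟨ [⟦b⟧+r]C2 (u Fin.zero) r ⟨
  (⟦ u Fin.zero ⟧ + r) C 2                               ∎
  where
  open ≡-Reasoning
  r : ℕ
  r = ∑[ i < n ] ⟦ u (Fin.suc i) ⟧

module _ {A : Set} where

  sumSublists : List A → (List A → ℕ) → ℕ
  sumSublists []       f = f []
  sumSublists (x ∷ xs) f = sumSublists xs f + sumSublists xs (f ∘ (x ∷_))

  sumSublists-cong : ∀ xs {f g : List A → ℕ} → (∀ S → f S ≡ g S) → sumSublists xs f ≡ sumSublists xs g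
  sumSublists-cong []       f≡g = f≡g []
  sumSublists-cong (x ∷ xs) f≡g =
    cong₂ _+_ (sumSublists-cong xs f≡g) (sumSublists-cong xs (f≡g ∘ (x ∷_)))

  sumSublists-mono-≤ : ∀ xs {f g : List A → ℕ} → (∀ S → f S ≤ g S) → sumSublists xs f ≤ sumSublists xs g
  sumSublists-mono-≤ []       f≤g = f≤g []
  sumSublists-mono-≤ (x ∷ xs) f≤g =
    +-mono-≤ (sumSublists-mono-≤ xs f≤g) (sumSublists-mono-≤ xs (f≤g ∘ (x ∷_)))

  sumSublists-mono-< : ∀ xs {f g : List A → ℕ} → (∀ S → f S ≤ g S) → f [] < g [] →
                       sumSublists xs f < sumSublists xs g
  sumSublists-mono-< []       f≤g f<g = f<g
  sumSublists-mono-< (x ∷ xs) f≤g f<g =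
    +-mono-<-≤ (sumSublists-mono-< xs f≤g f<g) (sumSublists-mono-≤ xs (f≤g ∘ (x ∷_)))

  sumSublists-+ : ∀ xs (f g : List A → ℕ) →
                  sumSublists xs (λ S → f S + g S) ≡ sumSublists xs f + sumSublists xs g
  sumSublists-+ []       f g = refl
  sumSublists-+ (x ∷ xs) f g = trans
    (cong₂ _+_ (sumSublists-+ xs f g) (sumSublists-+ xs (f ∘ (x ∷_)) (g ∘ (x ∷_))))
    (+-interchange (sumSublists xs f) _ _ _)
    where +-interchange : ∀ a b c d → a + b + (c + d) ≡ a + c + (b + d)
          +-interchange = solve-∀

  sumSublists-*ˡ : ∀ xs c (f : List A → ℕ) → sumSublists xs (λ S → c * f S) ≡ c * sumSublists xs f
  sumSublists-*ˡ []       c f = refl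
  sumSublists-*ˡ (x ∷ xs) c f = trans
    (cong₂ _+_ (sumSublists-*ˡ xs c f) (sumSublists-*ˡ xs c (f ∘ (x ∷_))))
    (sym (*-distribˡ-+ c _ _))

  sumSublists-[] : ∀ xs (f : List A → ℕ) → (∀ x S → f (x ∷ S) ≡ 0) → sumSublists xs f ≡ f []
  sumSublists-[] []       f f∷≡0 = refl
  sumSublists-[] (x ∷ xs) f f∷≡0 = begin
    sumSublists xs f + sumSublists xs (f ∘ (x ∷_))  ≡⟨ cong₂ _+_ (sumSublists-[] xs f f∷≡0)
                                                                  (sumSublists-[] xs _ (λ y S → f∷≡0 x (y ∷ S))) ⟩
    f [] + f (x ∷ [])                               ≡⟨ cong (f [] +_) (f∷≡0 x []) ⟩
    f [] + 0                                        ≡⟨ +-identityʳ (f []) ⟩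
    f []                                            ∎
    where open ≡-Reasoning

  sumSublists-long : ∀ xs (f : List A → ℕ) → (∀ S → length S ≤ length xs → f S ≡ 0) → sumSublists xs f ≡ 0
  sumSublists-long []       f f≡0 = f≡0 [] z≤n
  sumSublists-long (x ∷ xs) f f≡0 = cong₂ _+_
    (sumSublists-long xs f (λ S ≤xs → f≡0 S (m≤n⇒m≤1+n ≤xs)))
    (sumSublists-long xs (f ∘ (x ∷_)) (λ S ≤xs → f≡0 (x ∷ S) (s≤s ≤xs)))

  sumOver-subs : ∀ xs (g : List A → ℕ) → sumOver (subs xs) g ≡ sumSublists xs g
  sumOver-subs []       g = +-identityʳ (g [])
  sumOver-subs (x ∷ xs) g = begin
    sumOver (subs xs ++ map (x ∷_) (subs xs)) g              ≡⟨ sumOver-++ (subs xs) _ g ⟩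
    sumOver (subs xs) g + sumOver (map (x ∷_) (subs xs)) g  ≡⟨ cong (sumOver (subs xs) g +_)
                                                                    (sumOver-map (x ∷_) (subs xs) g) ⟩
    sumOver (subs xs) g + sumOver (subs xs) (g ∘ (x ∷_))    ≡⟨ cong₂ _+_ (sumOver-subs xs g)
                                                                          (sumOver-subs xs (g ∘ (x ∷_))) ⟩
    sumSublists (x ∷ xs) g                                  ∎
    where open ≡-Reasoning

  sumSublists-filterᵇ : ∀ (p : A → Bool) xs (q : List A → Bool) →
    sumSublists (filterᵇ p xs) (⟦_⟧ ∘ q) ≡ sumSublists xs (λ S → ⟦ q S ∧ all p S ⟧)
  sumSublists-filterᵇ p []       q = cong ⟦_⟧ (sym (∧-identityʳ (q [])))
  sumSublists-filterᵇ p (x ∷ xs) q with p x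
  ... | true  = cong₂ _+_ (sumSublists-filterᵇ p xs q) (sumSublists-filterᵇ p xs (q ∘ (x ∷_)))
  ... | false = sym (trans
    (cong (sumSublists xs (λ S → ⟦ q S ∧ all p S ⟧) +_)
          (sumSublists-long xs _ (λ S _ → cong ⟦_⟧ (∧-zeroʳ (q (x ∷ S))))))
    (trans (+-identityʳ _) (sym (sumSublists-filterᵇ p xs q))))

  count-subs-filterᵇ : ∀ (p : A → Bool) xs (q : List A → Bool) →
    length (filterᵇ q (subs (filterᵇ p xs))) ≡ sumSublists xs (λ S → ⟦ q S ∧ all p S ⟧)
  count-subs-filterᵇ p xs q = begin
    length (filterᵇ q (subs (filterᵇ p xs)))  ≡⟨ length-filterᵇ q (subs (filterᵇ p xs)) ⟩
    sumOver (subs (filterᵇ p xs)) (⟦_⟧ ∘ q)   ≡⟨ sumOver-subs (filterᵇ p xs) (⟦_⟧ ∘ q) ⟩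
    sumSublists (filterᵇ p xs) (⟦_⟧ ∘ q)      ≡⟨ sumSublists-filterᵇ p xs q ⟩
    sumSublists xs (λ S → ⟦ q S ∧ all p S ⟧)  ∎
    where open ≡-Reasoning

  count-subs-long : ∀ xs (q : List A → Bool) → (∀ S → length S ≤ length xs → q S ≡ false) →
                    length (filterᵇ q (subs xs)) ≡ 0
  count-subs-long xs q q≡false = begin
    length (filterᵇ q (subs xs))  ≡⟨ length-filterᵇ q (subs xs) ⟩
    sumOver (subs xs) (⟦_⟧ ∘ q)   ≡⟨ sumOver-subs xs (⟦_⟧ ∘ q) ⟩
    sumSublists xs (⟦_⟧ ∘ q)      ≡⟨ sumSublists-long xs _ (λ S ≤xs → cong ⟦_⟧ (q≡false S ≤xs)) ⟩
    0                             ∎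
    where open ≡-Reasoning

  data Insertion : List A → A → List A → Set where
    here  : ∀ {S e} → Insertion S e (e ∷ S)
    there : ∀ {x S e T} → Insertion S e T → Insertion (x ∷ S) e (x ∷ T)

  Insertion-length : ∀ {S e T} → Insertion S e T → length T ≡ suc (length S)
  Insertion-length here        = refl
  Insertion-length (there ins) = cong suc (Insertion-length ins)

  all-Insertion : ∀ (p : A → Bool) {S e T} → Insertion S e T → all p T ≡ p e ∧ all p S
  all-Insertion p here                      = refl
  all-Insertion p (there {x} {S} {e} {T} ins) = begin
    p x ∧ all p T          ≡⟨ cong (p x ∧_) (all-Insertion p ins) ⟩
    p x ∧ (p e ∧ all p S)  ≡⟨ solve 3 (λ a b c → a ⊕ (b ⊕ c) ⊜ b ⊕ (a ⊕ c)) refl (p x) (p e) (all p S) ⟩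
    p e ∧ (p x ∧ all p S)  ∎
    where open ≡-Reasoning
          open ∧-Solver using (solve; _⊕_; _⊜_)

  -- sumInsertions xs F sums F S e T over the sublists S of xs and the elements e of xs
  -- outside S, where T is the sublist of xs with elements S ∪ {e}.
  sumInsertions : List A → (List A → A → List A → ℕ) → ℕ
  sumInsertions []       F = 0
  sumInsertions (x ∷ xs) F = sumInsertions xs F
                           + sumInsertions xs (λ S e T → F (x ∷ S) e (x ∷ T))
                           + sumSublists xs (λ S → F S x (x ∷ S))

  sumInsertions-cong : ∀ xs {F G : List A → A → List A → ℕ} →
                       (∀ {S e T} → Insertion S e T → F S e T ≡ G S e T) →
                       sumInsertions xs F ≡ sumInsertions xs G
  sumInsertions-cong []       F≡G = refl
  sumInsertions-cong (x ∷ xs) F≡G = cong₂ _+_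
    (cong₂ _+_ (sumInsertions-cong xs F≡G) (sumInsertions-cong xs (F≡G ∘ there)))
    (sumSublists-cong xs (λ S → F≡G here))

  sumInsertions-byTarget : ∀ xs (g : List A → ℕ) →
    sumInsertions xs (λ _ _ T → g T) ≡ sumSublists xs (λ T → length T * g T)
  sumInsertions-byTarget []       g = refl
  sumInsertions-byTarget (x ∷ xs) g = begin
    sumInsertions xs (λ _ _ T → g T) + sumInsertions xs (λ _ _ T → g (x ∷ T)) + sumSublists xs g′
      ≡⟨ cong₂ (λ a b → a + b + sumSublists xs g′)
               (sumInsertions-byTarget xs g) (sumInsertions-byTarget xs g′) ⟩
    Σℓg + sumSublists xs (λ T → length T * g′ T) + sumSublists xs g′
      ≡⟨ +-assoc Σℓg _ _ ⟩
    Σℓg + (sumSublists xs (λ T → length T * g′ T) + sumSublists xs g′)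
      ≡⟨ cong (Σℓg +_) (+-comm _ (sumSublists xs g′)) ⟩
    Σℓg + (sumSublists xs g′ + sumSublists xs (λ T → length T * g′ T))
      ≡⟨ cong (Σℓg +_) (sym (sumSublists-+ xs g′ (λ T → length T * g′ T))) ⟩
    sumSublists (x ∷ xs) (λ T → length T * g T)
      ∎
    where
    open ≡-Reasoning
    g′ : List A → ℕ
    g′ = g ∘ (x ∷_)
    Σℓg : ℕ
    Σℓg = sumSublists xs (λ T → length T * g T)

  sumInsertions-bySource : ∀ xs (g : List A → A → ℕ) → (∀ {S e} → e ∈ S → g S e ≡ 0) →
    sumInsertions xs (λ S e _ → g S e) ≡ sumSublists xs (λ S → sumOver xs (g S))
  sumInsertions-bySource []       g g∈≡0 = refl
  sumInsertions-bySource (x ∷ xs) g g∈≡0 = begin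
    sumInsertions xs (λ S e _ → g S e) + sumInsertions xs (λ S e _ → g (x ∷ S) e)
      + sumSublists xs (λ S → g S x)
      ≡⟨ cong₂ (λ a b → a + b + sumSublists xs (λ S → g S x))
               (sumInsertions-bySource xs g g∈≡0)
               (sumInsertions-bySource xs (g ∘ (x ∷_)) (g∈≡0 ∘ Any.there)) ⟩
    sumSublists xs (λ S → sumOver xs (g S)) + sumSublists xs (λ S → sumOver xs (g (x ∷ S)))
      + sumSublists xs (λ S → g S x)
      ≡⟨ rotate (sumSublists xs (λ S → sumOver xs (g S))) _ _ ⟩
    sumSublists xs (λ S → g S x) + sumSublists xs (λ S → sumOver xs (g S))
      + sumSublists xs (λ S → sumOver xs (g (x ∷ S)))
      ≡⟨ cong₂ _+_ (sym (sumSublists-+ xs (λ S → g S x) (λ S → sumOver xs (g S))))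
                   (sumSublists-cong xs (λ S → cong (_+ sumOver xs (g (x ∷ S))) (sym (g∈≡0 (Any.here refl))))) ⟩
    sumSublists (x ∷ xs) (λ S → sumOver (x ∷ xs) (g S))
      ∎
    where
    open ≡-Reasoning
    rotate : ∀ a b c → a + b + c ≡ c + a + b
    rotate = solve-∀

moment : (ℕ → ℕ) → ℕ → ℕ
moment f B = sumTo B (λ k → k * f k)

sumTo-mono-≤ : ∀ B {f g : ℕ → ℕ} → (∀ k → k ≤ B → f k ≤ g k) → sumTo B f ≤ sumTo B g
sumTo-mono-≤ zero    f≤g = f≤g 0 z≤n
sumTo-mono-≤ (suc B) f≤g =
  +-mono-≤ (sumTo-mono-≤ B (λ k k≤B → f≤g k (m≤n⇒m≤1+n k≤B))) (f≤g (suc B) ≤-refl)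

sumTo-*ʳ : ∀ B (f : ℕ → ℕ) c → sumTo B (λ j → f j * c) ≡ sumTo B f * c
sumTo-*ʳ zero    f c = refl
sumTo-*ʳ (suc B) f c =
  trans (cong (_+ f (suc B) * c) (sumTo-*ʳ B f c)) (sym (*-distribʳ-+ c (sumTo B f) (f (suc B))))

sumTo-truncate : ∀ {E B} (f : ℕ → ℕ) → E ≤ B → (∀ k → E < k → f k ≡ 0) → sumTo B f ≡ sumTo E f
sumTo-truncate {E} {zero}  f z≤n f≡0 = refl
sumTo-truncate {E} {suc B} f E≤B f≡0 with m≤n⇒m<n∨m≡n E≤B
... | inj₂ refl = refl
... | inj₁ (s≤s E≤B′) = begin
  sumTo B f + f (suc B)  ≡⟨ cong (sumTo B f +_) (f≡0 (suc B) (s≤s E≤B′)) ⟩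
  sumTo B f + 0          ≡⟨ +-identityʳ _ ⟩
  sumTo B f              ≡⟨ sumTo-truncate f E≤B′ f≡0 ⟩
  sumTo E f              ∎
  where open ≡-Reasoning

sumTo-complement : ∀ B s (f : ℕ → ℕ) → B < s → sumTo B (λ j → (s ∸ j) * f j) + moment f B ≡ s * sumTo B f
sumTo-complement zero    s f _   = +-identityʳ (s * f 0)
sumTo-complement (suc B) s f B<s = begin
  sumTo B (λ j → (s ∸ j) * f j) + (s ∸ suc B) * f (suc B) + (moment f B + suc B * f (suc B))
    ≡⟨ interchange (sumTo B (λ j → (s ∸ j) * f j)) _ _ _ ⟩
  sumTo B (λ j → (s ∸ j) * f j) + moment f B + ((s ∸ suc B) * f (suc B) + suc B * f (suc B))
    ≡⟨ cong₂ _+_ (sumTo-complement B s f (<-trans (n<1+n B) B<s)) (sym (*-distribʳ-+ (f (suc B)) (s ∸ suc B) (suc B))) ⟩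
  s * sumTo B f + (s ∸ suc B + suc B) * f (suc B)
    ≡⟨ cong (λ t → s * sumTo B f + t * f (suc B)) (m∸n+n≡m (<⇒≤ B<s)) ⟩
  s * sumTo B f + s * f (suc B)
    ≡⟨ *-distribˡ-+ s (sumTo B f) (f (suc B)) ⟨
  s * sumTo (suc B) f
    ∎
  where
  open ≡-Reasoning
  interchange : ∀ a b c d → a + b + (c + d) ≡ a + c + (b + d)
  interchange = solve-∀

tailWeight : (ℕ → ℕ) → ℕ → ℕ
tailWeight f B = sumTo B (λ j → (suc B ∸ j) * f j)

crossTerms : (ℕ → ℕ) → (ℕ → ℕ) → ℕ → ℕ
crossTerms f g B = moment f B * g (suc B) + moment g B * f (suc B) + suc B * f (suc B) * g (suc B)

crossTerms-comm : ∀ f g B → crossTerms f g B ≡ crossTerms g f B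
crossTerms-comm f g B = swap (moment f B) (moment g B) (suc B) (f (suc B)) (g (suc B))
  where
  swap : ∀ a b s u v → a * v + b * u + s * u * v ≡ b * u + a * v + s * v * u
  swap = solve-∀

moment-step : ∀ f g B → moment f (suc B) * sumTo (suc B) g
  ≡ moment f B * sumTo B g + tailWeight g B * f (suc B) + crossTerms f g B
moment-step f g B = begin
  (A + s * u) * (Z + v)                        ≡⟨ expand A Z s u v ⟩
  A * Z + A * v + u * (s * Z) + s * u * v      ≡⟨ cong (λ t → A * Z + A * v + u * t + s * u * v)
                                                       (sumTo-complement B s g (n<1+n B)) ⟨
  A * Z + A * v + u * (X + W) + s * u * v      ≡⟨ regroup A Z X W s u v ⟩
  A * Z + X * u + (A * v + W * u + s * u * v)  ∎
  where
  open ≡-Reasoning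
  A Z X W s u v : ℕ
  A = moment f B
  Z = sumTo B g
  X = tailWeight g B
  W = moment g B
  s = suc B
  u = f (suc B)
  v = g (suc B)
  expand : ∀ A Z s u v → (A + s * u) * (Z + v) ≡ A * Z + A * v + u * (s * Z) + s * u * v
  expand = solve-∀
  regroup : ∀ A Z X W s u v → A * Z + A * v + u * (X + W) + s * u * v ≡ A * Z + X * u + (A * v + W * u + s * u * v)
  regroup = solve-∀

-- Chebyshev's sum inequality in cross-multiplied form: if d_k / p_k is nonincreasing,
-- the d-weighted mean of k is at most the p-weighted one.
module _ (d p : ℕ → ℕ) (ratio-antitone : ∀ {j k} → j ≤ k → d k * p j ≤ d j * p k) where

  tailWeight-cross-≤ : ∀ B → tailWeight p B * d (suc B) ≤ tailWeight d B * p (suc B)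
  tailWeight-cross-≤ B = begin
    tailWeight p B * d (suc B)                            ≡⟨ sumTo-*ʳ B _ (d (suc B)) ⟨
    sumTo B (λ j → (suc B ∸ j) * p j * d (suc B))         ≤⟨ sumTo-mono-≤ B entry ⟩
    sumTo B (λ j → (suc B ∸ j) * d j * p (suc B))         ≡⟨ sumTo-*ʳ B _ (p (suc B)) ⟩
    tailWeight d B * p (suc B)                            ∎
    where
    open ≤-Reasoning
    entry : ∀ j → j ≤ B → (suc B ∸ j) * p j * d (suc B) ≤ (suc B ∸ j) * d j * p (suc B)
    entry j j≤B = begin
      (suc B ∸ j) * p j * d (suc B)    ≡⟨ reorder (suc B ∸ j) (p j) (d (suc B)) ⟩
      (suc B ∸ j) * (d (suc B) * p j)  ≤⟨ *-monoʳ-≤ (suc B ∸ j) (ratio-antitone (m≤n⇒m≤1+n j≤B)) ⟩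
      (suc B ∸ j) * (d j * p (suc B))  ≡⟨ *-assoc (suc B ∸ j) (d j) (p (suc B)) ⟨
      (suc B ∸ j) * d j * p (suc B)    ∎
      where
      reorder : ∀ a b c → a * b * c ≡ a * (c * b)
      reorder = solve-∀

  moment-cross-≤ : ∀ B → moment d B * sumTo B p ≤ moment p B * sumTo B d
  moment-cross-≤ zero    = z≤n
  moment-cross-≤ (suc B) = begin
    moment d (suc B) * sumTo (suc B) p                                       ≡⟨ moment-step d p B ⟩
    moment d B * sumTo B p + tailWeight p B * d (suc B) + crossTerms d p B
      ≤⟨ +-monoˡ-≤ (crossTerms d p B) (+-mono-≤ (moment-cross-≤ B) (tailWeight-cross-≤ B)) ⟩
    moment p B * sumTo B d + tailWeight d B * p (suc B) + crossTerms d p B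
      ≡⟨ cong (moment p B * sumTo B d + tailWeight d B * p (suc B) +_) (crossTerms-comm d p B) ⟩
    moment p B * sumTo B d + tailWeight d B * p (suc B) + crossTerms p d B   ≡⟨ moment-step p d B ⟨
    moment p (suc B) * sumTo (suc B) d                                       ∎
    where open ≤-Reasoning

  moment-cross-< : d 1 * p 0 < d 0 * p 1 → ∀ B → moment d (suc B) * sumTo (suc B) p < moment p (suc B) * sumTo (suc B) d
  moment-cross-< d₁p₀<d₀p₁ B = begin-strict
    moment d (suc B) * sumTo (suc B) p                                       ≡⟨ moment-step d p B ⟩
    moment d B * sumTo B p + tailWeight p B * d (suc B) + crossTerms d p B
      <⟨ +-monoˡ-< (crossTerms d p B) (leading-< B) ⟩
    moment p B * sumTo B d + tailWeight d B * p (suc B) + crossTerms d p B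
      ≡⟨ cong (moment p B * sumTo B d + tailWeight d B * p (suc B) +_) (crossTerms-comm d p B) ⟩
    moment p B * sumTo B d + tailWeight d B * p (suc B) + crossTerms p d B   ≡⟨ moment-step p d B ⟨
    moment p (suc B) * sumTo (suc B) d                                       ∎
    where
    open ≤-Reasoning
    leading-< : ∀ B → moment d B * sumTo B p + tailWeight p B * d (suc B) < moment p B * sumTo B d + tailWeight d B * p (suc B)
    leading-< zero    = +-mono-≤-< (moment-cross-≤ 0) (subst₂ _<_ (*-comm (d 1) (p 0) ∙ cong (_* d 1) (sym (+-identityʳ (p 0))))
                                                                 (cong (_* p 1) (sym (+-identityʳ (d 0)))) d₁p₀<d₀p₁)
      where _∙_ = trans
    leading-< (suc B) = +-mono-<-≤ (moment-cross-< d₁p₀<d₀p₁ B) (tailWeight-cross-≤ (suc B))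

-- d ≤ p is needed only to keep the ratio d_k / p_k monotone once p vanishes.
module _ (d p c : ℕ → ℕ) (d≤p : ∀ k → d k ≤ p k)
         (d-rec : ∀ k → suc k * d (suc k) ≤ c k * d k)
         (p-rec : ∀ k → suc k * p (suc k) ≡ c k * p k) where

  ratio-step : ∀ k → d (suc k) * p k ≤ d k * p (suc k)
  ratio-step k = *-cancelˡ-≤ (suc k) (begin
    suc k * (d (suc k) * p k)  ≡⟨ *-assoc (suc k) (d (suc k)) (p k) ⟨
    suc k * d (suc k) * p k    ≤⟨ *-monoˡ-≤ (p k) (d-rec k) ⟩
    c k * d k * p k            ≡⟨ reorder (c k) (d k) (p k) ⟩
    d k * (c k * p k)          ≡⟨ cong (d k *_) (p-rec k) ⟨
    d k * (suc k * p (suc k))  ≡⟨ reorder′ (d k) (suc k) (p (suc k)) ⟩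
    suc k * (d k * p (suc k))  ∎)
    where
    open ≤-Reasoning
    reorder : ∀ a b e → a * b * e ≡ b * (a * e)
    reorder = solve-∀
    reorder′ : ∀ a b e → a * (b * e) ≡ b * (a * e)
    reorder′ = solve-∀

  ratio-antitone-+ : ∀ j t → d (t + j) * p j ≤ d j * p (t + j)
  ratio-antitone-+ j zero    = ≤-refl
  ratio-antitone-+ j (suc t) with p (t + j) in pₖ≡
  ... | zero = ≤-trans (≤-reflexive (cong (_* p j) dₖ₊₁≡0)) z≤n
    where
    pₖ₊₁≡0 : p (suc (t + j)) ≡ 0
    pₖ₊₁≡0 with m*n≡0⇒m≡0∨n≡0 (suc (t + j))
                  (trans (p-rec (t + j)) (trans (cong (c (t + j) *_) pₖ≡) (*-zeroʳ (c (t + j)))))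
    ... | inj₂ p≡0 = p≡0
    dₖ₊₁≡0 : d (suc (t + j)) ≡ 0
    dₖ₊₁≡0 = n≤0⇒n≡0 (subst (d (suc (t + j)) ≤_) pₖ₊₁≡0 (d≤p _))
  ... | suc _ = *-cancelʳ-≤ _ _ (p k) {{pₖ≢0}} (begin
    d (suc k) * p j * p k      ≡⟨ swap (d (suc k)) (p j) (p k) ⟩
    d (suc k) * p k * p j      ≤⟨ *-monoˡ-≤ (p j) (ratio-step k) ⟩
    d k * p (suc k) * p j      ≡⟨ swap (d k) (p (suc k)) (p j) ⟩
    d k * p j * p (suc k)      ≤⟨ *-monoˡ-≤ (p (suc k)) (ratio-antitone-+ j t) ⟩
    d j * p k * p (suc k)      ≡⟨ swap (d j) (p k) (p (suc k)) ⟩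
    d j * p (suc k) * p k      ∎)
    where
    open ≤-Reasoning
    k : ℕ
    k = t + j
    pₖ≢0 : NonZero (p k)
    pₖ≢0 rewrite pₖ≡ = _
    swap : ∀ a b e → a * b * e ≡ a * e * b
    swap = solve-∀

  ratio-antitone : ∀ {j k} → j ≤ k → d k * p j ≤ d j * p k
  ratio-antitone {j} {k} j≤k = subst (λ k → d k * p j ≤ d j * p k) (m∸n+n≡m j≤k) (ratio-antitone-+ j (k ∸ j))

/-≤-cross : ∀ a b c d .{{_ : NonZero b}} .{{_ : NonZero d}} →
            a * d ≤ c * b → ℤ.+ a ℚ./ b ℚ.≤ ℤ.+ c ℚ./ d
/-≤-cross a (suc b) c (suc d) ad≤cb = toℚᵘ-cancel-≤
  (ℚᵘᵖ.≤-respˡ-≃ (ℚᵘᵖ.≃-sym (toℚᵘ-fromℚᵘ (ℚᵘ.mkℚᵘ (ℤ.+ a) b)))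
  (ℚᵘᵖ.≤-respʳ-≃ (ℚᵘᵖ.≃-sym (toℚᵘ-fromℚᵘ (ℚᵘ.mkℚᵘ (ℤ.+ c) d)))
    (ℚᵘ.*≤* (subst₂ ℤ._≤_ (ℤᵖ.pos-* a (suc d)) (ℤᵖ.pos-* c (suc b)) (ℤ.+≤+ ad≤cb)))))

freePairs : ℕ → ℕ → ℕ
freePairs n k = (n ∸ (k + k)) C 2

module _ {n : ℕ} where

  private
    Kₙ : Graph n
    Kₙ = complete n

  =ᵛ-sym : ∀ (a b : Fin n) → (a =ᵛ b) ≡ (b =ᵛ a)
  =ᵛ-sym a b = ≡ᵇ-sym (toℕ a) (toℕ b)

  =ᵛ-both-false : ∀ (i a b : Fin n) → (a =ᵛ b) ≡ false → (i =ᵛ a) ∧ (i =ᵛ b) ≡ false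
  =ᵛ-both-false i a b a≠b with i =ᵛ a in i=a
  ... | false = refl
  ... | true with toℕ-injective (≡ᵇ⇒≡ (toℕ i) (toℕ a) (subst T (sym i=a) _))
  ...   | refl = a≠b

  disjoint-sym : ∀ (e f : Edge n) → disjoint e f ≡ disjoint f e
  disjoint-sym (a , b) (c , d)
    rewrite =ᵛ-sym c a | =ᵛ-sym c b | =ᵛ-sym d a | =ᵛ-sym d b =
      cong not (solve 4 (λ p q r s → p ⊕ (q ⊕ (r ⊕ s)) ⊜ p ⊕ (r ⊕ (q ⊕ s))) refl
                        (a =ᵛ c) (a =ᵛ d) (b =ᵛ c) (b =ᵛ d))
    where open ∨-Solver using (solve; _⊕_; _⊜_)

  disjoint-self : ∀ (e : Edge n) → disjoint e e ≡ false
  disjoint-self (a , b) rewrite ≡ᵇ-refl (toℕ a) = refl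

  avoids : Edge n → List (Edge n) → Bool
  avoids e = all (disjoint e)

  avoids-∈ : ∀ {e S} → e ∈ S → avoids e S ≡ false
  avoids-∈ {e} (Any.here refl) rewrite disjoint-self e = refl
  avoids-∈ {e} {x ∷ S} (Any.there e∈S) = trans (cong (disjoint e x ∧_) (avoids-∈ e∈S)) (∧-zeroʳ _)

  isMatching-Insertion : ∀ {S e T} → Insertion S e T → isMatching T ≡ isMatching S ∧ avoids e S
  isMatching-Insertion {S} {e} here = ∧-comm (avoids e S) (isMatching S)
  isMatching-Insertion (there {x} {S} {e} {T} ins) = begin
    avoids x T ∧ isMatching T
      ≡⟨ cong₂ _∧_ (trans (all-Insertion (disjoint x) ins) (cong (_∧ avoids x S) (disjoint-sym x e)))
                   (isMatching-Insertion ins) ⟩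
    (disjoint e x ∧ avoids x S) ∧ (isMatching S ∧ avoids e S)
      ≡⟨ solve 4 (λ a b c d → (a ⊕ b) ⊕ (c ⊕ d) ⊜ (b ⊕ c) ⊕ (a ⊕ d)) refl
                 (disjoint e x) (avoids x S) (isMatching S) (avoids e S) ⟩
    (avoids x S ∧ isMatching S) ∧ (disjoint e x ∧ avoids e S)
      ∎
    where open ≡-Reasoning
          open ∧-Solver using (solve; _⊕_; _⊜_)

  -- edges G unfolds to filterᵇ (isEdge G) pairs.
  pairs : List (Edge n)
  pairs = concatMap (λ i → map (i ,_) (filterᵇ (λ j → toℕ i <ᵇ toℕ j) (allFin n))) (allFin n)

  sumOver-pairs : ∀ g → sumOver pairs g ≡ ∑[ i < n ] ∑[ j < n ] (⟦ toℕ i <ᵇ toℕ j ⟧ * g (i , j))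
  sumOver-pairs g = begin
    sumOver pairs g                                ≡⟨ sumOver-concatMap row (allFin n) g ⟩
    sumOver (allFin n) (λ i → sumOver (row i) g)   ≡⟨ sumOver-tabulate {n = n} (λ i → i) (λ i → sumOver (row i) g) ⟩
    ∑[ i < n ] sumOver (row i) g                   ≡⟨ sum-cong-≗ {n} sum-row ⟩
    ∑[ i < n ] ∑[ j < n ] (⟦ toℕ i <ᵇ toℕ j ⟧ * g (i , j)) ∎
    where
    open ≡-Reasoning
    above : Fin n → List (Fin n)
    above i = filterᵇ (λ j → toℕ i <ᵇ toℕ j) (allFin n)
    row : Fin n → List (Edge n)
    row i = map (i ,_) (above i)
    sum-row : ∀ i → sumOver (row i) g ≡ ∑[ j < n ] (⟦ toℕ i <ᵇ toℕ j ⟧ * g (i , j))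
    sum-row i = begin
      sumOver (map (i ,_) (above i)) g                              ≡⟨ sumOver-map (i ,_) (above i) g ⟩
      sumOver (above i) (λ j → g (i , j))                           ≡⟨ sumOver-filterᵇ _ (allFin n) _ ⟩
      sumOver (allFin n) (λ j → ⟦ toℕ i <ᵇ toℕ j ⟧ * g (i , j))      ≡⟨ sumOver-tabulate {n = n} (λ j → j) _ ⟩
      ∑[ j < n ] (⟦ toℕ i <ᵇ toℕ j ⟧ * g (i , j))                   ∎

  isEdge : Graph n → Edge n → Bool
  isEdge G e = adj G (proj₁ e) (proj₂ e)

  isMatchingOfSize : Graph n → ℕ → List (Edge n) → Bool
  isMatchingOfSize G k S = (isMatching S ∧ (length S ≡ᵇ k)) ∧ all (isEdge G) S

  m≡sumSublists : ∀ G k → m G k ≡ sumSublists pairs (⟦_⟧ ∘ isMatchingOfSize G k)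
  m≡sumSublists G k = count-subs-filterᵇ (isEdge G) pairs (λ M → isMatching M ∧ (length M ≡ᵇ k))

  freeEdges : Graph n → List (Edge n) → ℕ
  freeEdges G S = sumOver pairs (λ e → ⟦ avoids e S ∧ isEdge G e ⟧)

  isMatchingOfSize-Insertion : ∀ G k {S e T} → Insertion S e T →
    ⟦ isMatchingOfSize G (suc k) T ⟧ ≡ ⟦ isMatchingOfSize G k S ⟧ * ⟦ avoids e S ∧ isEdge G e ⟧
  isMatchingOfSize-Insertion G k {S} {e} {T} ins = begin
    ⟦ (isMatching T ∧ (length T ≡ᵇ suc k)) ∧ all (isEdge G) T ⟧
      ≡⟨ cong ⟦_⟧ (cong₂ _∧_ (cong₂ _∧_ (isMatching-Insertion ins) (cong (_≡ᵇ suc k) (Insertion-length ins)))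
                             (all-Insertion (isEdge G) ins)) ⟩
    ⟦ ((isMatching S ∧ avoids e S) ∧ (length S ≡ᵇ k)) ∧ (isEdge G e ∧ all (isEdge G) S) ⟧
      ≡⟨ cong ⟦_⟧ (solve 5 (λ a b c d f → ((a ⊕ b) ⊕ c) ⊕ (d ⊕ f) ⊜ ((a ⊕ c) ⊕ f) ⊕ (b ⊕ d)) refl
                           (isMatching S) (avoids e S) (length S ≡ᵇ k) (isEdge G e) (all (isEdge G) S)) ⟩
    ⟦ isMatchingOfSize G k S ∧ (avoids e S ∧ isEdge G e) ⟧
      ≡⟨ ⟦⟧-∧ (isMatchingOfSize G k S) _ ⟩
    ⟦ isMatchingOfSize G k S ⟧ * ⟦ avoids e S ∧ isEdge G e ⟧
      ∎
    where open ≡-Reasoning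
          open ∧-Solver using (solve; _⊕_; _⊜_)

  isMatchingOfSize⇒length : ∀ G k S → isMatchingOfSize G k S ≡ true → length S ≡ k
  isMatchingOfSize⇒length G k S M = ≡ᵇ⇒≡ (length S) k
    (subst T (sym (∧-conicalʳ (isMatching S) _ (∧-conicalˡ _ (all (isEdge G) S) M))) _)

  -- (k+1) m(G, k+1) counts the pairs (M, e) of a k-matching M and an edge e with M ∪ {e} a
  -- matching: each (k+1)-matching arises once from each of its k+1 edges.
  matching-double-count : ∀ G k →
    suc k * m G (suc k) ≡ sumSublists pairs (λ S → ⟦ isMatchingOfSize G k S ⟧ * freeEdges G S)
  matching-double-count G k = begin
    suc k * m G (suc k)                             ≡⟨ cong (suc k *_) (m≡sumSublists G (suc k)) ⟩
    suc k * sumSublists pairs M₊                    ≡⟨ sumSublists-*ˡ pairs (suc k) M₊ ⟨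
    sumSublists pairs (λ T → suc k * M₊ T)          ≡⟨ sumSublists-cong pairs size-weight ⟩
    sumSublists pairs (λ T → length T * M₊ T)       ≡⟨ sumInsertions-byTarget pairs M₊ ⟨
    sumInsertions pairs (λ _ _ T → M₊ T)            ≡⟨ sumInsertions-cong pairs (isMatchingOfSize-Insertion G k) ⟩
    sumInsertions pairs (λ S e _ → M S * free S e)  ≡⟨ sumInsertions-bySource pairs (λ S e → M S * free S e) not-free ⟩
    sumSublists pairs (λ S → sumOver pairs (λ e → M S * free S e))
      ≡⟨ sumSublists-cong pairs (λ S → sumOver-*ˡ pairs (M S) (free S)) ⟩
    sumSublists pairs (λ S → M S * freeEdges G S)   ∎
    where
    open ≡-Reasoning
    M M₊ : List (Edge n) → ℕ
    M  S = ⟦ isMatchingOfSize G k S ⟧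
    M₊ T = ⟦ isMatchingOfSize G (suc k) T ⟧
    free : List (Edge n) → Edge n → ℕ
    free S e = ⟦ avoids e S ∧ isEdge G e ⟧
    size-weight : ∀ T → suc k * M₊ T ≡ length T * M₊ T
    size-weight T with isMatchingOfSize G (suc k) T in M₊T
    ... | false = trans (*-zeroʳ (suc k)) (sym (*-zeroʳ (length T)))
    ... | true  = cong (_* 1) (sym (isMatchingOfSize⇒length G (suc k) T M₊T))
    not-free : ∀ {S e} → e ∈ S → M S * free S e ≡ 0
    not-free {S} {e} e∈S = trans (cong (λ b → M S * ⟦ b ∧ isEdge G e ⟧) (avoids-∈ e∈S)) (*-zeroʳ (M S))

  isEdge-complete : ∀ G e → isEdge G e ≡ true → isEdge Kₙ e ≡ true
  isEdge-complete G (a , b) ab∈G with a =ᵛ b in a=b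
  ... | false = refl
  ... | true with toℕ-injective (≡ᵇ⇒≡ (toℕ a) (toℕ b) (subst T (sym a=b) _))
  ...   | refl = trans (sym (adj-irrefl G a)) ab∈G

  all-isEdge-complete : ∀ G S → all (isEdge G) S ≡ true → all (isEdge Kₙ) S ≡ true
  all-isEdge-complete G []      _     = refl
  all-isEdge-complete G (e ∷ S) e∷S⊆G = cong₂ _∧_
    (isEdge-complete G e (∧-conicalˡ _ _ e∷S⊆G)) (all-isEdge-complete G S (∧-conicalʳ _ _ e∷S⊆G))

  isMatchingOfSize-complete : ∀ G k S → isMatchingOfSize G k S ≡ true → isMatchingOfSize Kₙ k S ≡ true
  isMatchingOfSize-complete G k S M = cong₂ _∧_
    (∧-conicalˡ _ _ M) (all-isEdge-complete G S (∧-conicalʳ (isMatching S ∧ (length S ≡ᵇ k)) _ M))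

  m≤m-complete : ∀ G k → m G k ≤ m Kₙ k
  m≤m-complete G k = begin
    m G k                                       ≡⟨ m≡sumSublists G k ⟩
    sumSublists pairs (⟦_⟧ ∘ isMatchingOfSize G k)
      ≤⟨ sumSublists-mono-≤ pairs (λ S → ⟦⟧-mono (isMatchingOfSize-complete G k S)) ⟩
    sumSublists pairs (⟦_⟧ ∘ isMatchingOfSize Kₙ k)  ≡⟨ m≡sumSublists Kₙ k ⟨
    m Kₙ k                                      ∎
    where open ≤-Reasoning

  freeEdges≤freeEdges-complete : ∀ G S → freeEdges G S ≤ freeEdges Kₙ S
  freeEdges≤freeEdges-complete G S = sumOver-mono-≤ pairs (λ e → ⟦⟧-mono (λ free →
    cong₂ _∧_ (∧-conicalˡ _ _ free) (isEdge-complete G e (∧-conicalʳ (avoids e S) _ free))))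

  m-zero : ∀ G → m G 0 ≡ 1
  m-zero G = trans (m≡sumSublists G 0) (sumSublists-[] pairs _ nonempty)
    where
    nonempty : ∀ e S → ⟦ isMatchingOfSize G 0 (e ∷ S) ⟧ ≡ 0
    nonempty e S = cong (λ b → ⟦ b ∧ all (isEdge G) (e ∷ S) ⟧) (∧-zeroʳ (isMatching (e ∷ S)))

  m-beyond : ∀ (G : Graph n) k → length (edges G) < k → m G k ≡ 0
  m-beyond G k |E|<k = count-subs-long (edges G) (λ M → isMatching M ∧ (length M ≡ᵇ k)) (λ S |S|≤|E| →
    trans (cong (isMatching S ∧_) (size≢k (≤-<-trans |S|≤|E| |E|<k))) (∧-zeroʳ (isMatching S)))
    where
    size≢k : ∀ {ℓ} → ℓ < k → (ℓ ≡ᵇ k) ≡ false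
    size≢k {ℓ} ℓ<k = ¬-not (λ ℓ=k → <⇒≢ ℓ<k (≡ᵇ⇒≡ ℓ k (subst T (sym ℓ=k) _)))

  misses : Fin n → Edge n → Bool
  misses v e = not (v =ᵛ proj₁ e ∨ v =ᵛ proj₂ e)

  uncovered : Fin n → List (Edge n) → Bool
  uncovered v = all (misses v)

  avoids≡uncovered∧uncovered : ∀ i j S → avoids (i , j) S ≡ uncovered i S ∧ uncovered j S
  avoids≡uncovered∧uncovered i j []      = refl
  avoids≡uncovered∧uncovered i j (e ∷ S) = begin
    disjoint (i , j) e ∧ avoids (i , j) S
      ≡⟨ cong₂ _∧_ (not-∨-split (i =ᵛ proj₁ e) (i =ᵛ proj₂ e) (j =ᵛ proj₁ e) (j =ᵛ proj₂ e))
                   (avoids≡uncovered∧uncovered i j S) ⟩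
    (misses i e ∧ misses j e) ∧ (uncovered i S ∧ uncovered j S)
      ≡⟨ solve 4 (λ a b c d → (a ⊕ b) ⊕ (c ⊕ d) ⊜ (a ⊕ c) ⊕ (b ⊕ d)) refl
                 (misses i e) (misses j e) (uncovered i S) (uncovered j S) ⟩
    (misses i e ∧ uncovered i S) ∧ (misses j e ∧ uncovered j S)
      ∎
    where open ≡-Reasoning
          open ∧-Solver using (solve; _⊕_; _⊜_)

  sum-uncovered-∷ : ∀ a b S → (a =ᵛ b) ≡ false → uncovered a S ≡ true → uncovered b S ≡ true →
    ∑[ i < n ] ⟦ uncovered i S ⟧ ≡ ∑[ i < n ] ⟦ uncovered i ((a , b) ∷ S) ⟧ + 1 + 1
  sum-uncovered-∷ a b S a≠b a∉S b∉S = begin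
    ∑[ i < n ] ⟦ uncovered i S ⟧
      ≡⟨ sum-cong-≗ {n} (λ i → ⟦⟧-split (i =ᵛ a) (i =ᵛ b) (uncovered i S) (=ᵛ-both-false i a b a≠b)) ⟩
    ∑[ i < n ] (U i + δ a i + δ b i)
      ≡⟨ ∑-distrib-+ (λ i → U i + δ a i) (δ b) ⟩
    ∑[ i < n ] (U i + δ a i) + ∑[ i < n ] δ b i
      ≡⟨ cong (_+ ∑[ i < n ] δ b i) (∑-distrib-+ U (δ a)) ⟩
    ∑[ i < n ] U i + ∑[ i < n ] δ a i + ∑[ i < n ] δ b i
      ≡⟨ cong₂ (λ x y → ∑[ i < n ] U i + x + y) (trans (sum-δ a _) (cong ⟦_⟧ a∉S))
                                                  (trans (sum-δ b _) (cong ⟦_⟧ b∉S)) ⟩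
    ∑[ i < n ] U i + 1 + 1
      ∎
    where
    open ≡-Reasoning
    U : Fin n → ℕ
    U i = ⟦ uncovered i ((a , b) ∷ S) ⟧
    δ : Fin n → Fin n → ℕ
    δ v i = ⟦ i =ᵛ v ⟧ * ⟦ uncovered i S ⟧

  uncovered-count : ∀ S → isMatching S ≡ true → all (isEdge Kₙ) S ≡ true →
    ∑[ i < n ] ⟦ uncovered i S ⟧ + (length S + length S) ≡ n
  uncovered-count []            _          _    = trans (+-identityʳ _) (sum-ones n)
  uncovered-count ((a , b) ∷ S) matching S⊆Kₙ = begin
    ∑[ i < n ] ⟦ uncovered i ((a , b) ∷ S) ⟧ + (suc ℓ + suc ℓ)
      ≡⟨ regroup (∑[ i < n ] ⟦ uncovered i ((a , b) ∷ S) ⟧) ℓ ⟩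
    ∑[ i < n ] ⟦ uncovered i ((a , b) ∷ S) ⟧ + 1 + 1 + (ℓ + ℓ)
      ≡⟨ cong (_+ (ℓ + ℓ)) (sum-uncovered-∷ a b S a≠b (∧-conicalˡ _ _ ab∉S) (∧-conicalʳ _ _ ab∉S)) ⟨
    ∑[ i < n ] ⟦ uncovered i S ⟧ + (ℓ + ℓ)
      ≡⟨ uncovered-count S (∧-conicalʳ (avoids (a , b) S) _ matching) (∧-conicalʳ (not (a =ᵛ b)) _ S⊆Kₙ) ⟩
    n ∎
    where
    open ≡-Reasoning
    ℓ : ℕ
    ℓ = length S
    regroup : ∀ x y → x + (suc y + suc y) ≡ x + 1 + 1 + (y + y)
    regroup = solve-∀
    ab∉S : uncovered a S ∧ uncovered b S ≡ true
    ab∉S = trans (sym (avoids≡uncovered∧uncovered a b S)) (∧-conicalˡ _ (isMatching S) matching)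
    a≠b : (a =ᵛ b) ≡ false
    a≠b = not-injective (∧-conicalˡ _ (all (isEdge Kₙ) S) S⊆Kₙ)

  freeEdges-complete : ∀ k S → isMatchingOfSize Kₙ k S ≡ true → freeEdges Kₙ S ≡ freePairs n k
  freeEdges-complete k S M = begin
    freeEdges Kₙ S                                 ≡⟨ sumOver-pairs _ ⟩
    ∑[ i < n ] ∑[ j < n ] (⟦ toℕ i <ᵇ toℕ j ⟧ * ⟦ avoids (i , j) S ∧ isEdge Kₙ (i , j) ⟧)
                                                   ≡⟨ sum-cong-≗ {n} (λ i → sum-cong-≗ {n} (entry i)) ⟩
    pairProducts (λ i → ⟦ uncovered i S ⟧)         ≡⟨ pairProducts-⟦⟧ (λ i → uncovered i S) ⟩
    r C 2                                          ≡⟨ cong (_C 2) r≡n∸2k ⟩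
    freePairs n k                              ∎
    where
    open ≡-Reasoning
    r : ℕ
    r = ∑[ i < n ] ⟦ uncovered i S ⟧
    r≡n∸2k : r ≡ n ∸ (k + k)
    r≡n∸2k = begin
      r                       ≡⟨ m+n∸n≡m r (k + k) ⟨
      r + (k + k) ∸ (k + k)   ≡⟨ cong (λ ℓ → r + (ℓ + ℓ) ∸ (k + k)) (isMatchingOfSize⇒length Kₙ k S M) ⟨
      r + (length S + length S) ∸ (k + k)
        ≡⟨ cong (_∸ (k + k)) (uncovered-count S (∧-conicalˡ _ _ (∧-conicalˡ _ (all (isEdge Kₙ) S) M))
                                                (∧-conicalʳ (isMatching S ∧ (length S ≡ᵇ k)) _ M)) ⟩
      n ∸ (k + k)             ∎
    entry : ∀ i j → ⟦ toℕ i <ᵇ toℕ j ⟧ * ⟦ avoids (i , j) S ∧ isEdge Kₙ (i , j) ⟧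
                  ≡ ⟦ toℕ i <ᵇ toℕ j ⟧ * (⟦ uncovered i S ⟧ * ⟦ uncovered j S ⟧)
    entry i j with toℕ i <ᵇ toℕ j in i<j
    ... | false = refl
    ... | true  = cong (1 *_) (begin
      ⟦ avoids (i , j) S ∧ not (i =ᵛ j) ⟧  ≡⟨ cong (λ b → ⟦ avoids (i , j) S ∧ not b ⟧) (<ᵇ⇒≢ᵇ (toℕ i) (toℕ j) i<j) ⟩
      ⟦ avoids (i , j) S ∧ true ⟧          ≡⟨ cong ⟦_⟧ (trans (∧-identityʳ _) (avoids≡uncovered∧uncovered i j S)) ⟩
      ⟦ uncovered i S ∧ uncovered j S ⟧    ≡⟨ ⟦⟧-∧ (uncovered i S) (uncovered j S) ⟩
      ⟦ uncovered i S ⟧ * ⟦ uncovered j S ⟧ ∎)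

  m-suc≤ : ∀ G k → suc k * m G (suc k) ≤ freePairs n k * m G k
  m-suc≤ G k = begin
    suc k * m G (suc k)                            ≡⟨ matching-double-count G k ⟩
    sumSublists pairs (λ S → M S * freeEdges G S)  ≤⟨ sumSublists-mono-≤ pairs (λ S → ⟦⟧*-≤ (bound S)) ⟩
    sumSublists pairs (λ S → c * M S)              ≡⟨ sumSublists-*ˡ pairs c M ⟩
    c * sumSublists pairs M                        ≡⟨ cong (c *_) (m≡sumSublists G k) ⟨
    c * m G k                                      ∎
    where
    open ≤-Reasoning
    c : ℕ
    c = freePairs n k
    M : List (Edge n) → ℕ
    M S = ⟦ isMatchingOfSize G k S ⟧
    bound : ∀ S → isMatchingOfSize G k S ≡ true → freeEdges G S ≤ c
    bound S S-matching = ≤-trans (freeEdges≤freeEdges-complete G S)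
      (≤-reflexive (freeEdges-complete k S (isMatchingOfSize-complete G k S S-matching)))

  m-suc-complete : ∀ k → suc k * m Kₙ (suc k) ≡ freePairs n k * m Kₙ k
  m-suc-complete k = begin
    suc k * m Kₙ (suc k)                            ≡⟨ matching-double-count Kₙ k ⟩
    sumSublists pairs (λ S → M S * freeEdges Kₙ S)  ≡⟨ sumSublists-cong pairs (λ S → ⟦⟧*-≡ (freeEdges-complete k S)) ⟩
    sumSublists pairs (λ S → c * M S)               ≡⟨ sumSublists-*ˡ pairs c M ⟩
    c * sumSublists pairs M                         ≡⟨ cong (c *_) (m≡sumSublists Kₙ k) ⟨
    c * m Kₙ k                                      ∎
    where
    open ≡-Reasoning
    c : ℕ
    c = freePairs n k
    M : List (Edge n) → ℕ
    M S = ⟦ isMatchingOfSize Kₙ k S ⟧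

  freeEdges-[]-<-ordered : ∀ G (a b : Fin n) → toℕ a < toℕ b → adj G a b ≡ false →
                           freeEdges G [] < freeEdges Kₙ []
  freeEdges-[]-<-ordered G a b a<b ab∉G = subst₂ _<_ (sym (sumOver-pairs _)) (sym (sumOver-pairs _))
    (sum-mono-< (λ x → sum-mono-≤ (entry≤ x)) a (sum-mono-< (entry≤ a) b entry<))
    where
    entry≤ : ∀ x y → ⟦ toℕ x <ᵇ toℕ y ⟧ * ⟦ isEdge G (x , y) ⟧ ≤ ⟦ toℕ x <ᵇ toℕ y ⟧ * ⟦ isEdge Kₙ (x , y) ⟧
    entry≤ x y = *-monoʳ-≤ ⟦ toℕ x <ᵇ toℕ y ⟧ (⟦⟧-mono (isEdge-complete G (x , y)))
    entry< : ⟦ toℕ a <ᵇ toℕ b ⟧ * ⟦ isEdge G (a , b) ⟧ < ⟦ toℕ a <ᵇ toℕ b ⟧ * ⟦ isEdge Kₙ (a , b) ⟧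
    entry< rewrite <⇒<ᵇ≡true a<b | ab∉G | <ᵇ⇒≢ᵇ (toℕ a) (toℕ b) (<⇒<ᵇ≡true a<b) = s≤s z≤n

  freeEdges-[]-< : ∀ G (i j : Fin n) → i ≢ j → adj G i j ≡ false → freeEdges G [] < freeEdges Kₙ []
  freeEdges-[]-< G i j i≢j ij∉G with <-cmp (toℕ i) (toℕ j)
  ... | tri< i<j _   _   = freeEdges-[]-<-ordered G i j i<j ij∉G
  ... | tri≈ _   i=j _   = ⊥-elim (i≢j (toℕ-injective i=j))
  ... | tri> _   _   j<i = freeEdges-[]-<-ordered G j i j<i (trans (adj-sym G j i) ij∉G)

  m-one-< : ∀ G (i j : Fin n) → i ≢ j → adj G i j ≡ false → m G 1 < m Kₙ 1
  m-one-< G i j i≢j ij∉G = begin-strict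
    m G 1                                                         ≡⟨ *-identityˡ (m G 1) ⟨
    1 * m G 1                                                     ≡⟨ matching-double-count G 0 ⟩
    sumSublists pairs (λ S → ⟦ isMatchingOfSize G 0 S ⟧ * freeEdges G S)
      <⟨ sumSublists-mono-< pairs (λ S → *-mono-≤ (⟦⟧-mono (isMatchingOfSize-complete G 0 S))
                                                (freeEdges≤freeEdges-complete G S))
                                  (+-monoˡ-< 0 (freeEdges-[]-< G i j i≢j ij∉G)) ⟩
    sumSublists pairs (λ S → ⟦ isMatchingOfSize Kₙ 0 S ⟧ * freeEdges Kₙ S) ≡⟨ matching-double-count Kₙ 0 ⟨
    1 * m Kₙ 1                                                    ≡⟨ *-identityˡ (m Kₙ 1) ⟩
    m Kₙ 1                                                        ∎
    where open ≤-Reasoning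

  totalMatchings≡sumTo : ∀ G B → length (edges G) ≤ B → totalMatchings G ≡ sumTo B (m G)
  totalMatchings≡sumTo G B |E|≤B = sym (sumTo-truncate (m G) |E|≤B (m-beyond G))

  weightedMatchings≡moment : ∀ G B → length (edges G) ≤ B → weightedMatchings G ≡ moment (m G) B
  weightedMatchings≡moment G B |E|≤B = sym (sumTo-truncate (λ k → k * m G k) |E|≤B
    (λ k |E|<k → trans (cong (k *_) (m-beyond G k |E|<k)) (*-zeroʳ k)))

module _ {n : ℕ} (G : Graph n) where

  private
    Kₙ : Graph n
    Kₙ = complete n

    B : ℕ
    B = length (edges G) + length (edges Kₙ)

    cross-products : ∀ (R : ℕ → ℕ → Set) →
      R (moment (m G) (suc B) * sumTo (suc B) (m Kₙ)) (moment (m Kₙ) (suc B) * sumTo (suc B) (m G)) →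
      R (weightedMatchings G * totalMatchings Kₙ) (weightedMatchings Kₙ * totalMatchings G)
    cross-products R = subst₂ R
      (sym (cong₂ _*_ (weightedMatchings≡moment G (suc B) |EG|≤) (totalMatchings≡sumTo Kₙ (suc B) |EK|≤)))
      (sym (cong₂ _*_ (weightedMatchings≡moment Kₙ (suc B) |EK|≤) (totalMatchings≡sumTo G (suc B) |EG|≤)))
      where
      |EG|≤ : length (edges G) ≤ suc B
      |EG|≤ = m≤n⇒m≤1+n (m≤m+n _ _)
      |EK|≤ : length (edges Kₙ) ≤ suc B
      |EK|≤ = m≤n⇒m≤1+n (m≤n+m _ _)

    mG/mK-antitone : ∀ {j k} → j ≤ k → m G k * m Kₙ j ≤ m G j * m Kₙ k
    mG/mK-antitone = ratio-antitone (m G) (m Kₙ) (freePairs n) (m≤m-complete G) (m-suc≤ G) m-suc-complete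

  weightedMatchings-cross-≤ : weightedMatchings G * totalMatchings Kₙ ≤ weightedMatchings Kₙ * totalMatchings G
  weightedMatchings-cross-≤ = cross-products _≤_ (moment-cross-≤ (m G) (m Kₙ) mG/mK-antitone (suc B))

  weightedMatchings-cross-< : ∀ i j → i ≢ j → adj G i j ≡ false →
    weightedMatchings G * totalMatchings Kₙ < weightedMatchings Kₙ * totalMatchings G
  weightedMatchings-cross-< i j i≢j ij∉G = cross-products _<_
    (moment-cross-< (m G) (m Kₙ) mG/mK-antitone m₁<m₁ B)
    where
    m₁<m₁ : m G 1 * m Kₙ 0 < m G 0 * m Kₙ 1
    m₁<m₁ = subst₂ _<_ (cong (m G 1 *_) (sym (m-zero Kₙ))) (cong (_* m Kₙ 1) (sym (m-zero G)))
      (subst₂ _<_ (sym (*-identityʳ (m G 1))) (sym (*-identityˡ (m Kₙ 1))) (m-one-< G i j i≢j ij∉G))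

corollary3p8 : (n : ℕ) (G : Graph n) →
    (av G ℚ.≤ av (complete n)) ×
    (av (complete n) ≡ av G → ∀ (i j : Fin n) → i ≢ j → adj G i j ≡ true)
corollary3p8 n G = av≤av-complete , av≡av-complete⇒complete
  where
  Kₙ : Graph n
  Kₙ = complete n
  instance
    total-G≢0 : NonZero (totalMatchings G)
    total-G≢0 = totalMatchings-nonzero G
    total-Kₙ≢0 : NonZero (totalMatchings Kₙ)
    total-Kₙ≢0 = totalMatchings-nonzero Kₙ
  av≤av-complete : av G ℚ.≤ av Kₙ
  av≤av-complete = /-≤-cross (weightedMatchings G) (totalMatchings G)
                             (weightedMatchings Kₙ) (totalMatchings Kₙ) (weightedMatchings-cross-≤ G)
  av≡av-complete⇒complete : av Kₙ ≡ av G → ∀ i j → i ≢ j → adj G i j ≡ true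
  av≡av-complete⇒complete avKₙ≡avG i j i≢j = ¬-not λ ij∉G → <-irrefl
    (sym (normalize-injective-≃ (weightedMatchings Kₙ) (weightedMatchings G)
                                (totalMatchings Kₙ) (totalMatchings G) avKₙ≡avG))
    (weightedMatchings-cross-< G i j i≢j ij∉G)
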